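{- Let $n\ge3$ be an integer. The SDS map $[C_n,(1+\mathrm{parity})_3,\mathrm{id}]\colon\mathbb F_2^n\to\mathbb F_2^n$ has a fixed point if and only if $4$ divides $n$.
   Context: $C_n$ is the cycle graph with vertices $v_1,\dots,v_n$, $v_i$ adjacent to $v_j$ iff $i-j\equiv\pm1\pmod n$. $(1+\mathrm{parity})_3(x,y,z)=1+x+y+z$ over $\mathbb F_2$. For $x=(x_1,\dots,x_n)\in\mathbb F_2^n$, the local update $F_{v_i}$ replaces $x_i$ by $1+x_{i-1}+x_i+x_{i+1}$ (indices mod $n$) and leaves other coordinates unchanged; the SDS map with identity update order is $[C_n,(1+\mathrm{parity})_3,\mathrm{id}]=F_{v_n}\circ\cdots\circ F_{v_1}$. -}

module Defs where

open import Data.Bool using (Bool; true; false; _xor_; not; if_then_else_)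
open import Data.Nat using (ℕ; zero; suc; _+_; _%_; NonZero)
open import Data.Fin using (Fin; toℕ; fromℕ<; _≟_)
open import Data.Nat.DivMod using (m%n<n)
open import Data.List using (List; foldl)
open import Data.List using (allFin) renaming (map to lmap)
open import Relation.Nullary using (does)

-- 𝔽₂ is modelled by Bool: false = 0, true = 1, addition = xor.
-- States x ∈ 𝔽₂ⁿ are functions Fin n → Bool; coordinate v_{i+1} ↔ index i.
State : ℕ → Set
State n = Fin n → Bool

oneParity3 : Bool → Bool → Bool → Bool
oneParity3 x y z = not (x xor y xor z)

shift : (n : ℕ) → .{{NonZero n}} → Fin n → ℕ → Fin n
shift n i k = fromℕ< (m%n<n (toℕ i + k) n)

-- predecessor i-1 ≡ i + (n-1) (mod n); successor i+1 (mod n)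
prevIx : (n : ℕ) → .{{NonZero n}} → Fin n → Fin n
prevIx (suc m) i = shift (suc m) i m

nextIx : (n : ℕ) → .{{NonZero n}} → Fin n → Fin n
nextIx n i = shift n i 1

localUpdate : (n : ℕ) → .{{NonZero n}} → Fin n → State n → State n
localUpdate n i x j =
  if does (j ≟ i)
  then oneParity3 (x (prevIx n i)) (x i) (x (nextIx n i))
  else x j

-- SDS map [C_n, (1+parity)_3, id] = F_{v_n} ∘ ⋯ ∘ F_{v_1}
-- (F_{v_1} applied first)
sdsMap : (n : ℕ) → .{{NonZero n}} → State n → State n
sdsMap n x = foldl (λ y i → localUpdate n i y) x (allFin n)

-- A local map changes only its own coordinate and each coordinate is updated once, so x is
-- fixed by the SDS map iff it is fixed by every local map, i.e. iff x_{i+1} = 1 + x_{i-1}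
-- for all i. Reading x as the n-periodic sequence g(a) = x_{a mod n}, this says
-- g(a + 2) = 1 + g(a); such a g has period 4 but no period 1, 2 or 3, so n-periodicity forces
-- 4 ∣ n. Conversely, when 4 ∣ n the pattern 0011 0011 … is a fixed point.
module Submission where

open import Defs
open import Data.Nat using (ℕ; _≥_; NonZero; >-nonZero; s≤s; z≤n)
open import Data.Nat.Properties using (≤-trans)
open import Data.Nat.Divisibility using (_∣_)
open import Data.Product using (∃)
open import Relation.Binary.PropositionalEquality using (_≡_)
open import Function.Bundles using (_⇔_)

open import Data.Bool using (Bool; true; false; not)
open import Data.Bool.Properties using (not-¬; not-involutive)
open import Data.Nat using (zero; suc; _+_; _*_; _%_; _/_; _<_)
open import Data.Nat.Properties using (+-assoc; +-comm; +-identityʳ)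
open import Data.Nat.DivMod using (m%n<n; m≡m%n+[m/n]*n; [m+n]%n≡m%n)
open import Data.Nat.Divisibility using (divides; m%n≡0⇒n∣m)
open import Data.Nat.Tactic.RingSolver using (solve-∀)
open import Data.Fin using (Fin; toℕ; fromℕ<; _≟_)
open import Data.Fin.Properties using (toℕ-injective; toℕ-fromℕ<)
open import Data.List using ([]; _∷_; foldl)
open import Data.List.Relation.Unary.All using (All; []; _∷_; lookup)
open import Data.List.Relation.Unary.All.Properties using (tabulate⁺)
open import Data.List.Relation.Unary.AllPairs using ([]; _∷_)
open import Data.List.Relation.Unary.Unique.Propositional using (Unique)
open import Data.List.Relation.Unary.Unique.Propositional.Properties using (allFin⁺)
open import Data.List.Membership.Propositional.Properties using (∈-allFin)
open import Data.Product using (_,_)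
open import Function using (_∘_)
open import Function.Bundles using (Equivalence; mk⇔)
open import Relation.Nullary using (¬_; yes; no)
open import Data.Empty using (⊥-elim)
open import Relation.Binary.PropositionalEquality
  using (refl; sym; trans; cong; subst; _≢_; _≗_; module ≡-Reasoning)

open Equivalence using (to; from)
open ≡-Reasoning

oneParity3≡middle⇔ : ∀ a b c → oneParity3 a b c ≡ b ⇔ c ≡ not a
oneParity3≡middle⇔ a b c = mk⇔ (fixed⇒ a b c) (⇒fixed a b c)
  where
    fixed⇒ : ∀ a b c → oneParity3 a b c ≡ b → c ≡ not a
    fixed⇒ false false false ()
    fixed⇒ false false true  _ = refl
    fixed⇒ false true  false ()
    fixed⇒ false true  true  _ = refl
    fixed⇒ true  false false _ = refl
    fixed⇒ true  false true  ()
    fixed⇒ true  true  false _ = refl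
    fixed⇒ true  true  true  ()

    ⇒fixed : ∀ a b c → c ≡ not a → oneParity3 a b c ≡ b
    ⇒fixed false false .true  refl = refl
    ⇒fixed false true  .true  refl = refl
    ⇒fixed true  false .false refl = refl
    ⇒fixed true  true  .false refl = refl

module LocalUpdates (n : ℕ) .{{_ : NonZero n}} where

  update : State n → Fin n → State n
  update y i = localUpdate n i y

  FixedAt : State n → Fin n → Set
  FixedAt y i = localUpdate n i y i ≡ y i

  localUpdate-self : ∀ y i →
    localUpdate n i y i ≡ oneParity3 (y (prevIx n i)) (y i) (y (nextIx n i))
  localUpdate-self y i with i ≟ i
  ... | yes _  = refl
  ... | no i≢i = ⊥-elim (i≢i refl)

  localUpdate-other : ∀ y {i j} → j ≢ i → localUpdate n i y j ≡ y j
  localUpdate-other y {i} {j} j≢i with j ≟ i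
  ... | yes j≡i = ⊥-elim (j≢i j≡i)
  ... | no _    = refl

  localUpdate-cong : ∀ {y z} i → y ≗ z → localUpdate n i y ≗ localUpdate n i z
  localUpdate-cong {y} {z} i y≗z j with j ≟ i
  ... | no _  = y≗z j
  ... | yes _ rewrite y≗z (prevIx n i) | y≗z i | y≗z (nextIx n i) = refl

  localUpdate-fixed : ∀ y i → FixedAt y i → localUpdate n i y ≗ y
  localUpdate-fixed y i fixed j with j ≟ i
  ... | yes refl = trans (sym (localUpdate-self y i)) fixed
  ... | no _     = refl

  foldl-cong : ∀ {y z} l → y ≗ z → foldl update y l ≗ foldl update z l
  foldl-cong []      y≗z = y≗z
  foldl-cong (i ∷ l) y≗z = foldl-cong l (localUpdate-cong i y≗z)

  foldl-other : ∀ y {j} l → All (j ≢_) l → foldl update y l j ≡ y j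
  foldl-other y []      []           = refl
  foldl-other y (i ∷ l) (j≢i ∷ j∉l) =
    trans (foldl-other (update y i) l j∉l) (localUpdate-other y j≢i)

  -- Coordinate i is touched only by the step at i, which sees the original y.
  foldl-fixed⇔ : ∀ y {l} → Unique l → foldl update y l ≗ y ⇔ All (FixedAt y) l
  foldl-fixed⇔ y {l} unique = mk⇔ (fixed⇒ l unique) (⇒fixed l)
    where
      fixed⇒ : ∀ l → Unique l → foldl update y l ≗ y → All (FixedAt y) l
      fixed⇒ []      []               _     = []
      fixed⇒ (i ∷ l) (i∉l ∷ unique) fixed = fixedAtᵢ ∷ fixed⇒ l unique fixed′
        where
          fixedAtᵢ : FixedAt y i
          fixedAtᵢ = trans (sym (foldl-other (update y i) l i∉l)) (fixed i)
          fixed′ : foldl update y l ≗ y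
          fixed′ j = trans (foldl-cong l (sym ∘ localUpdate-fixed y i fixedAtᵢ) j) (fixed j)

      ⇒fixed : ∀ l → All (FixedAt y) l → foldl update y l ≗ y
      ⇒fixed []      []                 j = refl
      ⇒fixed (i ∷ l) (fixedAtᵢ ∷ fixed) j =
        trans (foldl-cong l (localUpdate-fixed y i fixedAtᵢ) j) (⇒fixed l fixed j)

  sdsMap-fixed⇔ : ∀ y → sdsMap n y ≗ y ⇔ (∀ i → FixedAt y i)
  sdsMap-fixed⇔ y = mk⇔
    (λ fixed i → lookup (to (foldl-fixed⇔ y (allFin⁺ n)) fixed) (∈-allFin i))
    (λ fixed → from (foldl-fixed⇔ y (allFin⁺ n)) (tabulate⁺ fixed))

Periodic : {A : Set} → (ℕ → A) → ℕ → Set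
Periodic g p = ∀ a → g (p + a) ≡ g a

Antiperiodic : (ℕ → Bool) → ℕ → Set
Antiperiodic g p = ∀ a → g (p + a) ≡ not (g a)

periodic-∘ : ∀ {A B : Set} (h : A → B) {f : ℕ → A} {p} → Periodic f p → Periodic (h ∘ f) p
periodic-∘ h fₚ = cong h ∘ fₚ

module _ {A : Set} {g : ℕ → A} where

  periodic-+ : ∀ {p q} → Periodic g p → Periodic g q → Periodic g (p + q)
  periodic-+ {p} {q} gₚ g_q a = begin
    g (p + q + a)   ≡⟨ cong g (+-assoc p q a) ⟩
    g (p + (q + a)) ≡⟨ gₚ (q + a) ⟩
    g (q + a)       ≡⟨ g_q a ⟩
    g a             ∎

  periodic-* : ∀ k {p} → Periodic g p → Periodic g (k * p)
  periodic-* zero    gₚ a = refl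
  periodic-* (suc k) gₚ   = periodic-+ gₚ (periodic-* k gₚ)

  periodic-+-cancelˡ : ∀ {p q} → Periodic g (p + q) → Periodic g p → Periodic g q
  periodic-+-cancelˡ {p} {q} gₚ₊q gₚ a = begin
    g (q + a)       ≡⟨ gₚ (q + a) ⟨
    g (p + (q + a)) ≡⟨ cong g (+-assoc p q a) ⟨
    g (p + q + a)   ≡⟨ gₚ₊q a ⟩
    g a             ∎

  periodic-%-+ : ∀ {p} .{{_ : NonZero p}} → Periodic g p → ∀ a k → g (a % p + k) ≡ g (a + k)
  periodic-%-+ {p} gₚ a k = begin
    g (a % p + k)                 ≡⟨ periodic-* (a / p) gₚ (a % p + k) ⟨
    g (a / p * p + (a % p + k))   ≡⟨ cong g (+-assoc (a / p * p) (a % p) k) ⟨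
    g (a / p * p + a % p + k)     ≡⟨ cong (λ b → g (b + k)) (+-comm (a / p * p) (a % p)) ⟩
    g (a % p + a / p * p + k)     ≡⟨ cong (λ b → g (b + k)) (m≡m%n+[m/n]*n a p) ⟨
    g (a + k)                     ∎

  periodic-% : ∀ {p} .{{_ : NonZero p}} → Periodic g p → ∀ a → g (a % p) ≡ g a
  periodic-% {p} gₚ a = begin
    g (a % p)     ≡⟨ cong g (+-identityʳ (a % p)) ⟨
    g (a % p + 0) ≡⟨ periodic-%-+ gₚ a 0 ⟩
    g (a + 0)     ≡⟨ cong g (+-identityʳ a) ⟩
    g a           ∎

module _ {g : ℕ → Bool} where

  antiperiodic⇒periodic : ∀ {p} → Antiperiodic g p → Periodic g (p + p)
  antiperiodic⇒periodic {p} gₚ a = begin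
    g (p + p + a)         ≡⟨ cong g (+-assoc p p a) ⟩
    g (p + (p + a))       ≡⟨ gₚ (p + a) ⟩
    not (g (p + a))       ≡⟨ cong not (gₚ a) ⟩
    not (not (g a))       ≡⟨ not-involutive (g a) ⟩
    g a                   ∎

  antiperiodic⇒¬periodic : ∀ {p} → Antiperiodic g p → ¬ Periodic g p
  antiperiodic⇒¬periodic anti per = not-¬ (per 0) (anti 0)

  antiperiodic-respˡ : ∀ {f p} → f ≗ g → Antiperiodic g p → Antiperiodic f p
  antiperiodic-respˡ {f} {p} f≗g gₚ a = begin
    f (p + a)     ≡⟨ f≗g (p + a) ⟩
    g (p + a)     ≡⟨ gₚ a ⟩
    not (g a)     ≡⟨ cong not (f≗g a) ⟨
    not (f a)     ∎

  antiperiodic-2⇒period<4⇒≡0 : Antiperiodic g 2 → ∀ {r} → Periodic g r → r < 4 → r ≡ 0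
  antiperiodic-2⇒period<4⇒≡0 anti {0} _  _ = refl
  antiperiodic-2⇒period<4⇒≡0 anti {1} g₁ _ =
    ⊥-elim (antiperiodic⇒¬periodic anti (periodic-+ g₁ g₁))
  antiperiodic-2⇒period<4⇒≡0 anti {2} g₂ _ = ⊥-elim (antiperiodic⇒¬periodic anti g₂)
  antiperiodic-2⇒period<4⇒≡0 anti {3} g₃ _ =
    ⊥-elim (antiperiodic⇒¬periodic anti (periodic-+ g₁ g₁))
    where
      g₁ : Periodic g 1
      g₁ = periodic-+-cancelˡ {p = 3} (antiperiodic⇒periodic anti) g₃
  antiperiodic-2⇒period<4⇒≡0 anti {suc (suc (suc (suc _)))} _ (s≤s (s≤s (s≤s (s≤s ()))))

  antiperiodic-2⇒4∣period : Antiperiodic g 2 → ∀ {n} → Periodic g n → 4 ∣ n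
  antiperiodic-2⇒4∣period anti {n} gₙ =
    m%n≡0⇒n∣m n 4 (antiperiodic-2⇒period<4⇒≡0 anti g_[n%4] (m%n<n n 4))
    where
      n≡[n/4]*4+n%4 : n ≡ n / 4 * 4 + n % 4
      n≡[n/4]*4+n%4 = trans (m≡m%n+[m/n]*n n 4) (+-comm (n % 4) (n / 4 * 4))
      g_[n%4] : Periodic g (n % 4)
      g_[n%4] = periodic-+-cancelˡ (subst (Periodic g) n≡[n/4]*4+n%4 gₙ)
                                   (periodic-* (n / 4) (antiperiodic⇒periodic anti))

twoOffTwoOn : ℕ → Bool
twoOffTwoOn 0 = false
twoOffTwoOn 1 = false
twoOffTwoOn 2 = true
twoOffTwoOn 3 = true
twoOffTwoOn (suc (suc (suc (suc a)))) = twoOffTwoOn a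

twoOffTwoOn-antiperiodic : Antiperiodic twoOffTwoOn 2
twoOffTwoOn-antiperiodic 0 = refl
twoOffTwoOn-antiperiodic 1 = refl
twoOffTwoOn-antiperiodic 2 = refl
twoOffTwoOn-antiperiodic 3 = refl
twoOffTwoOn-antiperiodic (suc (suc (suc (suc a)))) = twoOffTwoOn-antiperiodic a

module Cycle (m : ℕ) where

  open LocalUpdates (suc m)

  fin : ℕ → Fin (suc m)
  fin a = fromℕ< (m%n<n a (suc m))

  toℕ-fin : ∀ a → toℕ (fin a) ≡ a % suc m
  toℕ-fin a = toℕ-fromℕ< _

  fin-periodic : Periodic fin (suc m)
  fin-periodic a = toℕ-injective (begin
    toℕ (fin (suc m + a)) ≡⟨ toℕ-fin (suc m + a) ⟩
    (suc m + a) % suc m   ≡⟨ cong (_% suc m) (+-comm (suc m) a) ⟩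
    (a + suc m) % suc m   ≡⟨ [m+n]%n≡m%n a (suc m) ⟩
    a % suc m             ≡⟨ toℕ-fin a ⟨
    toℕ (fin a)           ∎)

  periodic-∘toℕ∘fin : ∀ {A : Set} {h : ℕ → A} → Periodic h (suc m) → h ∘ toℕ ∘ fin ≗ h
  periodic-∘toℕ∘fin {h = h} hₙ a = trans (cong h (toℕ-fin a)) (periodic-% hₙ a)

  -- prevIx and nextIx unfold to fin (toℕ i + m) and fin (toℕ i + 1).
  fixedAt⇔ : ∀ x i → FixedAt x i ⇔ x (fin (toℕ i + 1)) ≡ not (x (fin (toℕ i + m)))
  fixedAt⇔ x i = mk⇔
    (λ fixed → to (oneParity3≡middle⇔ _ _ _) (trans (sym (localUpdate-self x i)) fixed))
    (λ next≡¬prev → trans (localUpdate-self x i) (from (oneParity3≡middle⇔ _ _ _) next≡¬prev))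

  allFixedAt⇔antiperiodic : ∀ x → (∀ i → FixedAt x i) ⇔ Antiperiodic (x ∘ fin) 2
  allFixedAt⇔antiperiodic x = mk⇔ fixed⇒ ⇒fixed
    where
      g : ℕ → Bool
      g = x ∘ fin

      gₙ : Periodic g (suc m)
      gₙ = periodic-∘ x {p = suc m} fin-periodic

      fixed⇒ : (∀ i → FixedAt x i) → Antiperiodic g 2
      fixed⇒ fixed a = begin
        g (2 + a)                  ≡⟨ cong g (+-comm 1 (suc a)) ⟩
        g (suc a + 1)              ≡⟨ periodic-%-+ gₙ (suc a) 1 ⟨
        g (suc a % suc m + 1)      ≡⟨ cong (λ b → g (b + 1)) (toℕ-fin (suc a)) ⟨
        g (toℕ i + 1)              ≡⟨ to (fixedAt⇔ x i) (fixed i) ⟩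
        not (g (toℕ i + m))        ≡⟨ cong (λ b → not (g (b + m))) (toℕ-fin (suc a)) ⟩
        not (g (suc a % suc m + m)) ≡⟨ cong not (periodic-%-+ gₙ (suc a) m) ⟩
        not (g (suc a + m))        ≡⟨ cong (λ b → not (g (suc b))) (+-comm a m) ⟩
        not (g (suc m + a))        ≡⟨ cong not (gₙ a) ⟩
        not (g a)                  ∎
        where i = fin (suc a)

      ⇒fixed : Antiperiodic g 2 → ∀ i → FixedAt x i
      ⇒fixed anti i = from (fixedAt⇔ x i) (begin
        g (a + 1)                  ≡⟨ gₙ (a + 1) ⟨
        g (suc m + (a + 1))        ≡⟨ cong g (n+[a+1]≡2+[a+m] m a) ⟩
        g (2 + (a + m))            ≡⟨ anti (a + m) ⟩
        not (g (a + m))            ∎)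
        where
          a = toℕ i
          n+[a+1]≡2+[a+m] : ∀ m a → suc m + (a + 1) ≡ 2 + (a + m)
          n+[a+1]≡2+[a+m] = solve-∀

theorem4p12 : (n : ℕ) → (n≥3 : n ≥ 3) →
    (∃ λ (x : State n) → ∀ i → sdsMap n {{>-nonZero (≤-trans (s≤s z≤n) n≥3)}} x i ≡ x i) ⇔ (4 ∣ n)
theorem4p12 zero    ()
theorem4p12 (suc m) _ = mk⇔ fixed⇒4∣n 4∣n⇒fixed
  where
    open LocalUpdates (suc m)
    open Cycle m

    fixed⇒4∣n : (∃ λ x → sdsMap (suc m) x ≗ x) → 4 ∣ suc m
    fixed⇒4∣n (x , fixed) = antiperiodic-2⇒4∣period
      (to (allFixedAt⇔antiperiodic x) (to (sdsMap-fixed⇔ x) fixed))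
      (periodic-∘ x {p = suc m} fin-periodic)

    4∣n⇒fixed : 4 ∣ suc m → ∃ λ x → sdsMap (suc m) x ≗ x
    4∣n⇒fixed (divides q n≡q*4) = twoOffTwoOn ∘ toℕ , from (sdsMap-fixed⇔ _)
      (from (allFixedAt⇔antiperiodic _)
        (antiperiodic-respˡ {p = 2} (periodic-∘toℕ∘fin periodₙ) twoOffTwoOn-antiperiodic))
      where
        periodₙ : Periodic twoOffTwoOn (suc m)
        periodₙ = subst (Periodic twoOffTwoOn) (sym n≡q*4)
          (periodic-* q (antiperiodic⇒periodic {p = 2} twoOffTwoOn-antiperiodic))
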